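{- (i) Let $n$ be odd and $\frac{n+1}{2}\le p\le n-2$. Put $r=\sum_{i=0}^{p-\frac{n-1}{2}}\binom{n}{i}$ and $s=\binom{p}{p-\frac{n-1}{2}}$. Then $|C^p(\mathcal{I}_{r-s+1})|<2^{n-1}-(r-2s+1)$. (ii) Let $n$ be even and $\frac{n}{2}+1\le p\le n-2$. Put $r'=\sum_{i=0}^{p-\frac{n}{2}}\binom{n}{i}+\binom{n-1}{p-\frac{n}{2}}$ and $s'=\binom{p-1}{p-\frac{n}{2}}$. Then $|C^p(\mathcal{I}_{r'-s'+1})|<2^{n-1}-(r'-2s'+1)$.
   Context: $[n]=\{1,\dots,n\}$ and $2^{[n]}$ is its power set. The simplicial ordering on $2^{[n]}$: for distinct $x,y\in 2^{[n]}$, $x<y$ if either $|x|<|y|$, or $|x|=|y|$ and $\min(x\triangle y)\in x$. For $0\le m\le 2^n$, $\mathcal{I}_m$ denotes the set of the first $m$ elements of $2^{[n]}$ in the simplicial ordering. For $A\subseteq 2^{[n]}$, $C^p[A]=\{y\in 2^{[n]}: |x\triangle y|\le p \text{ for every } x\in A\}$ and $C^p(A)=C^p[A]\setminus A$. -}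

module Defs where

open import Data.Bool using (Bool; true; false; _∧_; _∨_; not; if_then_else_)
open import Data.Nat using (ℕ; zero; suc; _+_; _<ᵇ_; _≡ᵇ_; _≤ᵇ_)
open import Data.List using (List; []; _∷_; map; _++_; length; filterᵇ; upTo)
open import Data.Bool.ListAction using (all)
open import Data.Nat.ListAction using (sum)
open import Data.Vec using (Vec; []; _∷_)
open import Data.Fin.Subset using (Subset; ∣_∣)
open import Data.Nat.Combinatorics using (_C_)

-- Subsets of [n] = {1,…,n} are represented as characteristic vectors
-- (Data.Fin.Subset): position i (i : Fin n) ↔ element i+1 of [n].

allSubsets : (n : ℕ) → List (Subset n)
allSubsets zero = [] ∷ []
allSubsets (suc n) = map (true ∷_) (allSubsets n) ++ map (false ∷_) (allSubsets n)

minSymDiffInFirst : ∀ {n} → Subset n → Subset n → Bool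
minSymDiffInFirst [] [] = false
minSymDiffInFirst (true ∷ x) (true ∷ y) = minSymDiffInFirst x y
minSymDiffInFirst (false ∷ x) (false ∷ y) = minSymDiffInFirst x y
minSymDiffInFirst (true ∷ x) (false ∷ y) = true
minSymDiffInFirst (false ∷ x) (true ∷ y) = false

_<ₛ_ : ∀ {n} → Subset n → Subset n → Bool
x <ₛ y = (∣ x ∣ <ᵇ ∣ y ∣) ∨ ((∣ x ∣ ≡ᵇ ∣ y ∣) ∧ minSymDiffInFirst x y)

rank : ∀ {n} → Subset n → ℕ
rank {n} y = length (filterᵇ (λ z → z <ₛ y) (allSubsets n))

inI : ∀ {n} → ℕ → Subset n → Bool
inI m y = rank y <ᵇ m

symDiffSize : ∀ {n} → Subset n → Subset n → ℕ
symDiffSize [] [] = 0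
symDiffSize (a ∷ x) (b ∷ y) = (if a ≡ᵇool b then 0 else 1) + symDiffSize x y
  where
  _≡ᵇool_ : Bool → Bool → Bool
  true ≡ᵇool true = true
  false ≡ᵇool false = true
  _ ≡ᵇool _ = false

inCclosed : ∀ {n} → ℕ → (Subset n → Bool) → Subset n → Bool
inCclosed {n} p A y = all (λ x → not (A x) ∨ (symDiffSize x y ≤ᵇ p)) (allSubsets n)

inCopen : ∀ {n} → ℕ → (Subset n → Bool) → Subset n → Bool
inCopen p A y = inCclosed p A y ∧ not (A y)

cardCpI : (n p m : ℕ) → ℕ
cardCpI n p m = length (filterᵇ (inCopen p (inI {n} m)) (allSubsets n))

sumTo : ℕ → (ℕ → ℕ) → ℕ
sumTo k f = sum (Data.List.map f (upTo (suc k)))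

-- Write n = 2k+1, t = p − k, a = n − p and m = r − s + 1. In the simplicial order the sets of
-- size < t and the t-sets meeting [a] come first (there are r − s of them) and x₀ = {a+1,…,a+t}
-- comes next, so 𝓘_m lies in the lower half {|y| ≤ k}, which has 2^(n−1) members. Testing a set
-- y of C^p[𝓘_m] against the first points outside y and against x₀ shows that either |y| ≤ k, or
-- |y| = k+1, y ⊇ [a] and y meets x₀; at most s − 1 sets are of the second kind. Since C^p(𝓘_m)
-- is disjoint from 𝓘_m, |C^p(𝓘_m)| + m ≤ 2^(n−1) + s − 1. For even n, 𝓘_m consists of the sets
-- {1} ∪ w with w in the odd-case family on [2, n] and the sets w ⊆ [2, n] with |w| ≤ t; a set of
-- C^p[𝓘_m] avoiding 1 is within p − 1 of the former, which reduces it to the odd case.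

module Submission where

open import Defs
open import Data.Nat using (ℕ; suc; _+_; _*_; _∸_; _^_; _≤_; _<_)
open import Data.Nat.Combinatorics using (_C_)
open import Data.Product using (_×_)

open import Data.Nat using (zero; z≤n; s≤s; z<s; _≤ᵇ_; _<ᵇ_; _≡ᵇ_; _≤?_)
open import Data.Nat.Properties
open import Data.Nat.Combinatorics using (nCk+nC[k+1]≡[n+1]C[k+1])
open import Data.Nat.ListAction using (sum)
open import Data.Nat.ListAction.Properties using (sum-++)
open import Data.Nat.Tactic.RingSolver using (solve-∀)
open import Algebra.Properties.CommutativeSemigroup +-commutativeSemigroup using (interchange)
open import Data.Bool using (Bool; true; false; T; not; _∧_; _∨_)
open import Data.Bool.Properties using (T-∨; T-∧) renaming (_≟_ to _≟ᵇ_)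
open import Data.Bool.ListAction using (all)
open import Data.List using ([]; _∷_; _++_; map; length; filterᵇ; upTo)
open import Data.List.Properties using (map-++; map-∘; upTo-∷ʳ)
open import Data.List.Membership.Propositional using (_∈_)
open import Data.List.Membership.Propositional.Properties using (∈-map⁺; ∈-++⁺ˡ; ∈-++⁺ʳ)
open import Data.List.Relation.Unary.Any using (here)
import Data.List.Relation.Unary.All as All
open import Data.List.Relation.Unary.All.Properties using (all⁺)
open import Data.Vec using ([]; _∷_)
open import Data.Vec.Properties using (≡-dec)
open import Data.Fin.Subset using (Subset; ∣_∣; ∁; _∩_)
open import Data.Fin.Subset.Properties using (∣∁p∣≡n∸∣p∣; ∣p∣≤n; ∩-comm)
open import Data.Product using (_,_; proj₁; proj₂)
open import Data.Sum using (_⊎_; inj₁; inj₂; [_,_]′; map₁)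
open import Data.Empty using (⊥-elim)
open import Data.Unit using (tt)
open import Function using (_∘_; Equivalence)
open import Relation.Nullary using (¬_; Dec; yes; no)
open import Relation.Nullary.Decidable using (⌊_⌋; toWitness; fromWitness)
open import Relation.Binary.PropositionalEquality

⟦_⟧ : Bool → ℕ
⟦ true ⟧  = 1
⟦ false ⟧ = 0

⟦⟧-mono : ∀ {b c} → (T b → T c) → ⟦ b ⟧ ≤ ⟦ c ⟧
⟦⟧-mono {false}         _   = z≤n
⟦⟧-mono {true} {true}   _   = ≤-refl
⟦⟧-mono {true} {false} b⇒c = ⊥-elim (b⇒c tt)

⟦⟧≡1 : ∀ {b} → T b → ⟦ b ⟧ ≡ 1
⟦⟧≡1 {true} _ = refl

⟦⟧≡0 : ∀ {b} → ¬ T b → ⟦ b ⟧ ≡ 0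
⟦⟧≡0 {false} _  = refl
⟦⟧≡0 {true}  ¬b = ⊥-elim (¬b tt)

⟦∨⟧ : ∀ b c → (T b → ¬ T c) → ⟦ b ∨ c ⟧ ≡ ⟦ b ⟧ + ⟦ c ⟧
⟦∨⟧ false c     _ = refl
⟦∨⟧ true  false _ = refl
⟦∨⟧ true  true  h = ⊥-elim (h tt tt)

⟦not∧⟧+⟦∧⟧ : ∀ b c → ⟦ not b ∧ c ⟧ + ⟦ b ∧ c ⟧ ≡ ⟦ c ⟧
⟦not∧⟧+⟦∧⟧ true  true  = refl
⟦not∧⟧+⟦∧⟧ true  false = refl
⟦not∧⟧+⟦∧⟧ false true  = refl
⟦not∧⟧+⟦∧⟧ false false = refl

T-not : ∀ {b} → ¬ T b → T (not b)
T-not {false} _  = tt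
T-not {true}  ¬b = ¬b tt

1≤⟦⟧+⟦⟧ : ∀ {b c} → T b ⊎ T c → 1 ≤ ⟦ b ⟧ + ⟦ c ⟧
1≤⟦⟧+⟦⟧ {true}        (inj₁ _) = s≤s z≤n
1≤⟦⟧+⟦⟧ {b}   {true}  (inj₂ _) = m≤n+m 1 ⟦ b ⟧

⟦∧not⟧+⟦⟧≤⟦⟧+⟦⟧ : ∀ c d g co e → (T g → T d) → (T g → T co) → (T c → T co ⊎ T e) →
  ⟦ c ∧ not d ⟧ + ⟦ g ⟧ ≤ ⟦ co ⟧ + ⟦ e ⟧
⟦∧not⟧+⟦⟧≤⟦⟧+⟦⟧ false d     false co e _   _    _   = z≤n
⟦∧not⟧+⟦⟧≤⟦⟧+⟦⟧ true  true  false co e _   _    _   = z≤n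
⟦∧not⟧+⟦⟧≤⟦⟧+⟦⟧ true  false false co e _   _    c⇒  = 1≤⟦⟧+⟦⟧ (c⇒ tt)
⟦∧not⟧+⟦⟧≤⟦⟧+⟦⟧ c     false true  co e g⇒d _    _   = ⊥-elim (g⇒d tt)
⟦∧not⟧+⟦⟧≤⟦⟧+⟦⟧ false true  true  co e _   g⇒co _   = 1≤⟦⟧+⟦⟧ (inj₁ (g⇒co tt))
⟦∧not⟧+⟦⟧≤⟦⟧+⟦⟧ true  true  true  co e _   g⇒co _   = 1≤⟦⟧+⟦⟧ (inj₁ (g⇒co tt))

∑ : ∀ n → (Subset n → ℕ) → ℕ
∑ zero    f = f []
∑ (suc n) f = ∑ n (λ x → f (true ∷ x)) + ∑ n (λ x → f (false ∷ x))

# : ∀ n → (Subset n → Bool) → ℕ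
# n P = ∑ n (λ x → ⟦ P x ⟧)

∑-cong : ∀ n {f g : Subset n → ℕ} → (∀ x → f x ≡ g x) → ∑ n f ≡ ∑ n g
∑-cong zero    f≡g = f≡g []
∑-cong (suc n) f≡g = cong₂ _+_ (∑-cong n (f≡g ∘ (true ∷_))) (∑-cong n (f≡g ∘ (false ∷_)))

∑-mono : ∀ n {f g : Subset n → ℕ} → (∀ x → f x ≤ g x) → ∑ n f ≤ ∑ n g
∑-mono zero    f≤g = f≤g []
∑-mono (suc n) f≤g = +-mono-≤ (∑-mono n (f≤g ∘ (true ∷_))) (∑-mono n (f≤g ∘ (false ∷_)))

∑-distrib-+ : ∀ n (f g : Subset n → ℕ) → ∑ n (λ x → f x + g x) ≡ ∑ n f + ∑ n g
∑-distrib-+ zero    f g = refl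
∑-distrib-+ (suc n) f g =
  trans (cong₂ _+_ (∑-distrib-+ n _ _) (∑-distrib-+ n _ _))
        (interchange (∑ n (f ∘ (true ∷_))) (∑ n (g ∘ (true ∷_)))
                     (∑ n (f ∘ (false ∷_))) (∑ n (g ∘ (false ∷_))))

∑-const : ∀ n c → ∑ n (λ _ → c) ≡ 2 ^ n * c
∑-const zero    c = sym (*-identityˡ c)
∑-const (suc n) c = trans (cong₂ _+_ (∑-const n c) (∑-const n c)) (double (2 ^ n) c)
  where
  double : ∀ x c → x * c + x * c ≡ (2 * x) * c
  double = solve-∀

∑-zero : ∀ n → ∑ n (λ _ → 0) ≡ 0
∑-zero n = trans (∑-const n 0) (*-zeroʳ (2 ^ n))

term≤∑ : ∀ n (f : Subset n → ℕ) x → f x ≤ ∑ n f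
term≤∑ zero    f []          = ≤-refl
term≤∑ (suc n) f (true ∷ x)  = ≤-trans (term≤∑ n _ x) (m≤m+n _ _)
term≤∑ (suc n) f (false ∷ x) = ≤-trans (term≤∑ n _ x) (m≤n+m _ _)

∑-∁ : ∀ n (f : Subset n → ℕ) → ∑ n f ≡ ∑ n (f ∘ ∁)
∑-∁ zero    f = refl
∑-∁ (suc n) f =
  trans (+-comm (∑ n (f ∘ (true ∷_))) _)
        (cong₂ _+_ (∑-∁ n (f ∘ (false ∷_))) (∑-∁ n (f ∘ (true ∷_))))

sum-map-allSubsets : ∀ n (f : Subset n → ℕ) → sum (map f (allSubsets n)) ≡ ∑ n f
sum-map-allSubsets zero    f = +-identityʳ (f [])
sum-map-allSubsets (suc n) f = begin
  sum (map f (map (true ∷_) xs ++ map (false ∷_) xs))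
    ≡⟨ cong sum (map-++ f (map (true ∷_) xs) _) ⟩
  sum (map f (map (true ∷_) xs) ++ map f (map (false ∷_) xs))
    ≡⟨ sum-++ (map f (map (true ∷_) xs)) _ ⟩
  sum (map f (map (true ∷_) xs)) + sum (map f (map (false ∷_) xs))
    ≡⟨ cong₂ (λ l l′ → sum l + sum l′) (map-∘ xs) (map-∘ xs) ⟨
  sum (map (f ∘ (true ∷_)) xs) + sum (map (f ∘ (false ∷_)) xs)
    ≡⟨ cong₂ _+_ (sum-map-allSubsets n _) (sum-map-allSubsets n _) ⟩
  ∑ (suc n) f ∎
  where
  open ≡-Reasoning
  xs = allSubsets n

length-filterᵇ : ∀ {A : Set} (P : A → Bool) xs → length (filterᵇ P xs) ≡ sum (map (⟦_⟧ ∘ P) xs)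
length-filterᵇ P []       = refl
length-filterᵇ P (x ∷ xs) with P x
... | true  = cong suc (length-filterᵇ P xs)
... | false = length-filterᵇ P xs

length-filterᵇ-allSubsets : ∀ n (P : Subset n → Bool) → length (filterᵇ P (allSubsets n)) ≡ # n P
length-filterᵇ-allSubsets n P = trans (length-filterᵇ P (allSubsets n)) (sum-map-allSubsets n _)

∈-allSubsets : ∀ {n} (x : Subset n) → x ∈ allSubsets n
∈-allSubsets []          = here refl
∈-allSubsets (true ∷ x)  = ∈-++⁺ˡ (∈-map⁺ (true ∷_) (∈-allSubsets x))
∈-allSubsets {suc n} (false ∷ x) = ∈-++⁺ʳ (map (true ∷_) (allSubsets n)) (∈-map⁺ (false ∷_) (∈-allSubsets x))

_⊆ᶠ_ : ∀ {n} → (Subset n → Bool) → (Subset n → Bool) → Set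
P ⊆ᶠ Q = ∀ x → T (P x) → T (Q x)

#-mono : ∀ {n} {P Q : Subset n → Bool} → P ⊆ᶠ Q → # n P ≤ # n Q
#-mono {n} P⊆Q = ∑-mono n (λ x → ⟦⟧-mono (P⊆Q x))

#-size≡ : ∀ n i → # n (λ (x : Subset n) → ∣ x ∣ ≡ᵇ i) ≡ n C i
#-size≡ zero    zero    = refl
#-size≡ zero    (suc i) = refl
#-size≡ (suc n) zero    = cong₂ _+_ (∑-zero n) (#-size≡ n zero)
#-size≡ (suc n) (suc i) =
  trans (cong₂ _+_ (#-size≡ n i) (#-size≡ n (suc i))) (nCk+nC[k+1]≡[n+1]C[k+1] n i)

sumTo-suc : ∀ j f → sumTo (suc j) f ≡ sumTo j f + f (suc j)
sumTo-suc j f = begin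
  sum (map f (upTo (suc (suc j))))            ≡⟨ cong (sum ∘ map f) (upTo-∷ʳ (suc j)) ⟨
  sum (map f (upTo (suc j) ++ suc j ∷ []))    ≡⟨ cong sum (map-++ f (upTo (suc j)) _) ⟩
  sum (map f (upTo (suc j)) ++ f (suc j) ∷ []) ≡⟨ sum-++ (map f (upTo (suc j))) _ ⟩
  sumTo j f + (f (suc j) + 0)                  ≡⟨ cong (sumTo j f +_) (+-identityʳ _) ⟩
  sumTo j f + f (suc j)                        ∎
  where open ≡-Reasoning

⟦<ᵇsuc⟧ : ∀ m j → ⟦ m <ᵇ suc j ⟧ ≡ ⟦ m <ᵇ j ⟧ + ⟦ m ≡ᵇ j ⟧
⟦<ᵇsuc⟧ zero    zero    = refl
⟦<ᵇsuc⟧ zero    (suc j) = refl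
⟦<ᵇsuc⟧ (suc m) zero    = refl
⟦<ᵇsuc⟧ (suc m) (suc j) = ⟦<ᵇsuc⟧ m j

⟦≤ᵇsuc⟧ : ∀ m j → ⟦ m ≤ᵇ suc j ⟧ ≡ ⟦ m ≤ᵇ j ⟧ + ⟦ m ≡ᵇ suc j ⟧
⟦≤ᵇsuc⟧ zero    j = refl
⟦≤ᵇsuc⟧ (suc m) j = ⟦<ᵇsuc⟧ m j

#-size≤ : ∀ n j → # n (λ (x : Subset n) → ∣ x ∣ ≤ᵇ j) ≡ sumTo j (n C_)
#-size≤ n zero    = trans (∑-cong n (λ x → ⟦≤ᵇ0⟧ ∣ x ∣)) (trans (#-size≡ n 0) (sym (+-identityʳ _)))
  where
  ⟦≤ᵇ0⟧ : ∀ m → ⟦ m ≤ᵇ 0 ⟧ ≡ ⟦ m ≡ᵇ 0 ⟧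
  ⟦≤ᵇ0⟧ zero    = refl
  ⟦≤ᵇ0⟧ (suc m) = refl
#-size≤ n (suc j) = begin
  # n (λ x → ∣ x ∣ ≤ᵇ suc j)
    ≡⟨ ∑-cong n (λ x → ⟦≤ᵇsuc⟧ ∣ x ∣ j) ⟩
  ∑ n (λ x → ⟦ ∣ x ∣ ≤ᵇ j ⟧ + ⟦ ∣ x ∣ ≡ᵇ suc j ⟧)
    ≡⟨ ∑-distrib-+ n _ _ ⟩
  # n (λ x → ∣ x ∣ ≤ᵇ j) + # n (λ x → ∣ x ∣ ≡ᵇ suc j)
    ≡⟨ cong₂ _+_ (#-size≤ n j) (#-size≡ n (suc j)) ⟩
  sumTo j (n C_) + n C suc j
    ≡⟨ sumTo-suc j (n C_) ⟨
  sumTo (suc j) (n C_) ∎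
  where open ≡-Reasoning

≤ᵇ-suc : ∀ m j → (suc m ≤ᵇ suc j) ≡ (m ≤ᵇ j)
≤ᵇ-suc zero    j = refl
≤ᵇ-suc (suc m) j = refl

sumTo-Pascal : ∀ n j → sumTo (suc j) (suc n C_) ≡ sumTo j (n C_) + sumTo (suc j) (n C_)
sumTo-Pascal n j = begin
  sumTo (suc j) (suc n C_)
    ≡⟨ #-size≤ (suc n) (suc j) ⟨
  ∑ n (λ x → ⟦ suc ∣ x ∣ ≤ᵇ suc j ⟧) + # n (λ x → ∣ x ∣ ≤ᵇ suc j)
    ≡⟨ cong (_+ # n (λ x → ∣ x ∣ ≤ᵇ suc j)) (∑-cong n (λ x → cong ⟦_⟧ (≤ᵇ-suc ∣ x ∣ j))) ⟩
  # n (λ x → ∣ x ∣ ≤ᵇ j) + # n (λ x → ∣ x ∣ ≤ᵇ suc j)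
    ≡⟨ cong₂ _+_ (#-size≤ n j) (#-size≤ n (suc j)) ⟩
  sumTo j (n C_) + sumTo (suc j) (n C_) ∎
  where open ≡-Reasoning

⟦≤ᵇ⟧+⟦≤ᵇ⟧≡1 : ∀ K c x → c + x ≡ suc (K + K) → ⟦ x ≤ᵇ K ⟧ + ⟦ c ≤ᵇ K ⟧ ≡ 1
⟦≤ᵇ⟧+⟦≤ᵇ⟧≡1 K c x c+x≡ with x ≤? K
... | yes x≤K = cong₂ _+_ (⟦⟧≡1 (≤⇒≤ᵇ x≤K)) (⟦⟧≡0 (<⇒≱ K<c ∘ ≤ᵇ⇒≤ c K))
  where
  K<c : K < c
  K<c = +-cancelʳ-< x K c (begin-strict
    K + x       ≤⟨ +-monoʳ-≤ K x≤K ⟩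
    K + K       <⟨ n<1+n _ ⟩
    suc (K + K) ≡⟨ c+x≡ ⟨
    c + x       ∎)
    where open ≤-Reasoning
... | no x≰K = cong₂ _+_ (⟦⟧≡0 (x≰K ∘ ≤ᵇ⇒≤ x K)) (⟦⟧≡1 (≤⇒≤ᵇ c≤K))
  where
  c≤K : c ≤ K
  c≤K = +-cancelʳ-≤ x c K (begin
    c + x       ≡⟨ c+x≡ ⟩
    suc (K + K) ≡⟨ +-suc K K ⟨
    K + suc K   ≤⟨ +-monoʳ-≤ K (≰⇒> x≰K) ⟩
    K + x       ∎)
    where open ≤-Reasoning

#-size≤-half : ∀ {n} K → n ≡ 2 * K + 1 → # n (λ x → ∣ x ∣ ≤ᵇ K) ≡ 2 ^ (2 * K)
#-size≤-half {n} K n≡ = double-injective (begin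
  # n small + # n small                        ≡⟨ cong (# n small +_) (∑-∁ n (⟦_⟧ ∘ small)) ⟩
  # n small + ∑ n (λ x → ⟦ small (∁ x) ⟧)      ≡⟨ ∑-distrib-+ n _ _ ⟨
  ∑ n (λ x → ⟦ small x ⟧ + ⟦ small (∁ x) ⟧)    ≡⟨ ∑-cong n complementary ⟩
  ∑ n (λ _ → 1)                                ≡⟨ ∑-const n 1 ⟩
  2 ^ n * 1                                    ≡⟨ *-identityʳ _ ⟩
  2 ^ n                                        ≡⟨ cong (2 ^_) (trans n≡ (+-comm _ 1)) ⟩
  2 ^ suc (2 * K)                              ≡⟨ cong (2 ^ (2 * K) +_) (+-identityʳ _) ⟩
  2 ^ (2 * K) + 2 ^ (2 * K)                    ∎)
  where
  open ≡-Reasoning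
  small : Subset n → Bool
  small x = ∣ x ∣ ≤ᵇ K
  double-injective : ∀ {a b} → a + a ≡ b + b → a ≡ b
  double-injective {a} {b} e =
    *-cancelˡ-≡ a b 2 (trans (cong (a +_) (+-identityʳ a)) (trans e (cong (b +_) (sym (+-identityʳ b)))))
  n≡suc[K+K] : n ≡ suc (K + K)
  n≡suc[K+K] = trans n≡ (arith K)
    where
    arith : ∀ K → 2 * K + 1 ≡ suc (K + K)
    arith = solve-∀
  complementary : ∀ x → ⟦ small x ⟧ + ⟦ small (∁ x) ⟧ ≡ 1
  complementary x = ⟦≤ᵇ⟧+⟦≤ᵇ⟧≡1 K ∣ ∁ x ∣ ∣ x ∣
    (trans (cong (_+ ∣ x ∣) (∣∁p∣≡n∸∣p∣ x)) (trans (m∸n+n≡m (∣p∣≤n x)) n≡suc[K+K]))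

meetsFirst : ∀ {n} → ℕ → Subset n → Bool
meetsFirst zero    _       = false
meetsFirst (suc a) []      = false
meetsFirst (suc a) (b ∷ x) = b ∨ meetsFirst a x

containsFirst : ∀ {n} → ℕ → Subset n → Bool
containsFirst zero    _       = true
containsFirst (suc a) []      = true
containsFirst (suc a) (b ∷ x) = b ∧ containsFirst a x

#-avoidsFirst : ∀ {n} a p i → a + p ≡ n →
  # n (λ x → not (meetsFirst a x) ∧ (∣ x ∣ ≡ᵇ i)) ≡ p C i
#-avoidsFirst zero    p i refl = #-size≡ p i
#-avoidsFirst (suc a) p i refl = cong₂ _+_ (∑-zero (a + p)) (#-avoidsFirst a p i refl)

#-containsFirst : ∀ {n} a p j → a + p ≡ n →
  # n (λ x → containsFirst a x ∧ (∣ x ∣ ≡ᵇ a + j)) ≡ p C j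
#-containsFirst zero    p j refl = #-size≡ p j
#-containsFirst (suc a) p j refl =
  trans (cong₂ _+_ (#-containsFirst a p j refl) (∑-zero (a + p))) (+-identityʳ _)

<ₛ-cases : ∀ {n} (z x : Subset n) → T (z <ₛ x) →
  ∣ z ∣ < ∣ x ∣ ⊎ (∣ z ∣ ≡ ∣ x ∣ × T (minSymDiffInFirst z x))
<ₛ-cases z x z<x with Equivalence.to (T-∨ {∣ z ∣ <ᵇ ∣ x ∣}) z<x
... | inj₁ lt   = inj₁ (<ᵇ⇒< _ _ lt)
... | inj₂ tie  with Equivalence.to (T-∧ {∣ z ∣ ≡ᵇ ∣ x ∣}) tie
...   | eq , first = inj₂ (≡ᵇ⇒≡ _ _ eq , first)

<ₛ⇒∣∣≤ : ∀ {n} (z x : Subset n) → T (z <ₛ x) → ∣ z ∣ ≤ ∣ x ∣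
<ₛ⇒∣∣≤ z x z<x with <ₛ-cases z x z<x
... | inj₁ lt      = <⇒≤ lt
... | inj₂ (eq , _) = ≤-reflexive eq

minSymDiff-meetsFirst : ∀ {n} a (z w : Subset n) →
  T (minSymDiffInFirst z w) → T (meetsFirst a w) → T (meetsFirst a z)
minSymDiff-meetsFirst (suc a) []          []          ()    _
minSymDiff-meetsFirst (suc a) (true ∷ z)  w           _     _ = tt
minSymDiff-meetsFirst (suc a) (false ∷ z) (false ∷ w) first m = minSymDiff-meetsFirst a z w first m

block : ∀ {n} → ℕ → ℕ → Subset n
block {zero}  _       _       = []
block {suc n} (suc a) t       = false ∷ block a t
block {suc n} zero    (suc t) = true ∷ block zero t
block {suc n} zero    zero    = false ∷ block zero zero

block-avoidsFirst : ∀ {n} a t → ¬ T (meetsFirst a (block {n} a t))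
block-avoidsFirst {suc n} (suc a) t = block-avoidsFirst a t

∣block∣ : ∀ {n} a t → a + t ≤ n → ∣ block {n} a t ∣ ≡ t
∣block∣ {zero}  zero    zero    _          = refl
∣block∣ {suc n} (suc a) t       (s≤s a+t≤n) = ∣block∣ a t a+t≤n
∣block∣ {suc n} zero    (suc t) (s≤s t≤n)   = cong suc (∣block∣ zero t t≤n)
∣block∣ {suc n} zero    zero    _           = ∣block∣ {n} zero zero z≤n

initial-block-least : ∀ {n} t (z : Subset n) →
  T (minSymDiffInFirst z (block zero t)) → ∣ z ∣ ≢ t
initial-block-least {suc n} (suc t) (true ∷ z)  first eq = initial-block-least t z first (suc-injective eq)
initial-block-least {suc n} zero    (false ∷ z) first eq = initial-block-least zero z first eq

block-least : ∀ {n} a t (z : Subset n) →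
  T (minSymDiffInFirst z (block a t)) → ∣ z ∣ ≡ t → T (meetsFirst a z)
block-least zero    t z           first eq = ⊥-elim (initial-block-least t z first eq)
block-least (suc a) t (true ∷ z)  first eq = tt
block-least (suc a) t (false ∷ z) first eq = block-least a t z first eq

WithinDist : ∀ {n} → ℕ → (Subset n → Bool) → Subset n → Set
WithinDist p A y = ∀ x → T (A x) → symDiffSize x y ≤ p

inCclosed⇒WithinDist : ∀ {n} p A (y : Subset n) → T (inCclosed p A y) → WithinDist p A y
inCclosed⇒WithinDist {n} p A y y∈C x x∈A =
  ≤ᵇ⇒≤ _ p (implied (A x) x∈A (All.lookup (all⁺ _ (allSubsets n) y∈C) (∈-allSubsets x)))
  where
  implied : ∀ b {c} → T b → T (not b ∨ c) → T c
  implied true _ c = c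

symDiffSize-disjoint : ∀ {n} (x y : Subset n) → ∣ x ∩ y ∣ ≡ 0 → symDiffSize x y ≡ ∣ x ∣ + ∣ y ∣
symDiffSize-disjoint []          []          _ = refl
symDiffSize-disjoint (true ∷ x)  (false ∷ y) e = cong suc (symDiffSize-disjoint x y e)
symDiffSize-disjoint (false ∷ x) (true ∷ y)  e = trans (cong suc (symDiffSize-disjoint x y e)) (sym (+-suc _ _))
symDiffSize-disjoint (false ∷ x) (false ∷ y) e = symDiffSize-disjoint x y e

-- The first j points outside y, or all of them if there are fewer.
firstOutside : ∀ {n} → Subset n → ℕ → Subset n
firstOutside []          j       = []
firstOutside (true ∷ y)  j       = false ∷ firstOutside y j
firstOutside (false ∷ y) zero    = false ∷ firstOutside y zero
firstOutside (false ∷ y) (suc j) = true ∷ firstOutside y j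

firstOutside-disjoint : ∀ {n} (y : Subset n) j → ∣ firstOutside y j ∩ y ∣ ≡ 0
firstOutside-disjoint []          j       = refl
firstOutside-disjoint (true ∷ y)  j       = firstOutside-disjoint y j
firstOutside-disjoint (false ∷ y) zero    = firstOutside-disjoint y zero
firstOutside-disjoint (false ∷ y) (suc j) = firstOutside-disjoint y j

∣firstOutside∣≤ : ∀ {n} (y : Subset n) j → ∣ firstOutside y j ∣ ≤ j
∣firstOutside∣≤ []          j       = z≤n
∣firstOutside∣≤ (true ∷ y)  j       = ∣firstOutside∣≤ y j
∣firstOutside∣≤ (false ∷ y) zero    = ∣firstOutside∣≤ y zero
∣firstOutside∣≤ (false ∷ y) (suc j) = s≤s (∣firstOutside∣≤ y j)

∣firstOutside∣-cases : ∀ {n} (y : Subset n) j →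
  ∣ firstOutside y j ∣ ≡ j ⊎ ∣ firstOutside y j ∣ + ∣ y ∣ ≡ n
∣firstOutside∣-cases []          zero    = inj₁ refl
∣firstOutside∣-cases []          (suc j) = inj₂ refl
∣firstOutside∣-cases (true ∷ y)  j       with ∣firstOutside∣-cases y j
... | inj₁ e = inj₁ e
... | inj₂ e = inj₂ (trans (+-suc _ _) (cong suc e))
∣firstOutside∣-cases (false ∷ y) zero    = inj₁ (n≤0⇒n≡0 (∣firstOutside∣≤ y zero))
∣firstOutside∣-cases (false ∷ y) (suc j) with ∣firstOutside∣-cases y j
... | inj₁ e = inj₁ (cong suc e)
... | inj₂ e = inj₂ (cong suc e)

∣firstOutside∣ : ∀ {n} (y : Subset n) j → j + ∣ y ∣ ≤ n → ∣ firstOutside y j ∣ ≡ j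
∣firstOutside∣ {n} y j j+∣y∣≤n with ∣firstOutside∣-cases y j
... | inj₁ e = e
... | inj₂ e = ≤-antisym (∣firstOutside∣≤ y j) (+-cancelʳ-≤ ∣ y ∣ j _ (subst (j + ∣ y ∣ ≤_) (sym e) j+∣y∣≤n))

firstOutside-avoidsFirst⇒containsFirst : ∀ {n} a (y : Subset n) j →
  ¬ T (meetsFirst a (firstOutside y (suc j))) → T (containsFirst a y)
firstOutside-avoidsFirst⇒containsFirst zero    y           j _       = tt
firstOutside-avoidsFirst⇒containsFirst (suc a) []          j _       = tt
firstOutside-avoidsFirst⇒containsFirst (suc a) (true ∷ y)  j avoids  =
  firstOutside-avoidsFirst⇒containsFirst a y j avoids
firstOutside-avoidsFirst⇒containsFirst (suc a) (false ∷ y) j avoids = avoids tt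

firstOutside-containsFirst : ∀ {n} a (y : Subset n) j →
  ¬ T (meetsFirst a y) → T (containsFirst a (firstOutside y (a + j)))
firstOutside-containsFirst zero    y           j _      = tt
firstOutside-containsFirst (suc a) []          j _      = tt
firstOutside-containsFirst (suc a) (true ∷ y)  j avoids = avoids tt
firstOutside-containsFirst (suc a) (false ∷ y) j avoids = firstOutside-containsFirst a y j avoids

WithinDist-size : ∀ {n} j q (A : Subset n → Bool) y →
  (∀ x → ∣ x ∣ ≤ j → T (A x)) → WithinDist q A y → q < n → j + ∣ y ∣ ≤ q
WithinDist-size j q A y small⊆A within q<n =
  [ (λ ∣x∣≡j → subst (λ k → k + ∣ y ∣ ≤ q) ∣x∣≡j dist)
  , (λ ∣x∣+∣y∣≡n → ⊥-elim (<⇒≱ q<n (subst (_≤ q) ∣x∣+∣y∣≡n dist)))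
  ]′ (∣firstOutside∣-cases y j)
  where
  x = firstOutside y j
  dist : ∣ x ∣ + ∣ y ∣ ≤ q
  dist = subst (_≤ q) (symDiffSize-disjoint x y (firstOutside-disjoint y j))
               (within x (small⊆A x (∣firstOutside∣≤ y j)))

WithinDist-disjoint : ∀ {n} q (A : Subset n → Bool) y x → WithinDist q A y →
  ∣ x ∩ y ∣ ≡ 0 → q < ∣ x ∣ + ∣ y ∣ → ¬ T (A x)
WithinDist-disjoint q A y x within disjoint far x∈A =
  <⇒≱ far (subst (_≤ q) (symDiffSize-disjoint x y disjoint) (within x x∈A))

inI-of-predecessors : ∀ {n} m (x : Subset n) (B : Subset n → Bool) →
  (λ z → z <ₛ x) ⊆ᶠ B → # n B < m → T (inI m x)
inI-of-predecessors {n} m x B pred⊆B #B<m = <⇒<ᵇ (begin-strict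
  rank x                 ≡⟨ length-filterᵇ-allSubsets n (λ z → z <ₛ x) ⟩
  # n (λ z → z <ₛ x)     ≤⟨ #-mono pred⊆B ⟩
  # n B                  <⟨ #B<m ⟩
  m                      ∎)
  where open ≤-Reasoning

-- G ⊆ 𝓘_m, so C^p(𝓘_m) and G are disjoint parts of Core ∪ E.
cardCpI-bound : ∀ {n} p s R (B G Core E : Subset n → Bool) →
  # n B + s ≡ R → suc (# n B) ≤ # n G → suc (# n E) ≤ s →
  (∀ x → T (G x) → (λ z → z <ₛ x) ⊆ᶠ B) →
  G ⊆ᶠ Core →
  (∀ A → G ⊆ᶠ A → ∀ y → WithinDist p A y → T (Core y) ⊎ T (E y)) →
  cardCpI n p (R ∸ s + 1) + (R + 1) < # n Core + 2 * s
cardCpI-bound {n} p s R B G Core E B+s≡R B<G E<s G-preds G⊆Core closure = begin-strict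
  X + (R + 1)            ≡⟨ cong (λ r → X + (r + 1)) B+s≡R ⟨
  X + (# n B + s + 1)    ≡⟨ arith₁ X (# n B) s ⟩
  X + suc (# n B) + s    ≤⟨ +-monoˡ-≤ s (+-monoʳ-≤ X B<G) ⟩
  X + # n G + s          ≤⟨ +-monoˡ-≤ s counting ⟩
  # n Core + # n E + s   <⟨ +-monoˡ-< s (+-monoʳ-< (# n Core) (n<1+n (# n E))) ⟩
  # n Core + suc (# n E) + s ≤⟨ +-monoˡ-≤ s (+-monoʳ-≤ (# n Core) E<s) ⟩
  # n Core + s + s       ≡⟨ arith₂ (# n Core) s ⟩
  # n Core + 2 * s       ∎
  where
  open ≤-Reasoning
  m = R ∸ s + 1
  X = cardCpI n p m
  A = inI {n} m
  #B<m : # n B < m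
  #B<m = subst (λ r → # n B < r ∸ s + 1) B+s≡R
           (subst (λ b → # n B < b + 1) (sym (m+n∸n≡m (# n B) s)) (≤-reflexive (+-comm 1 (# n B))))
  G⊆A : G ⊆ᶠ A
  G⊆A x x∈G = inI-of-predecessors m x B (G-preds x x∈G) #B<m
  pointwise : ∀ y → ⟦ inCopen p A y ⟧ + ⟦ G y ⟧ ≤ ⟦ Core y ⟧ + ⟦ E y ⟧
  pointwise y = ⟦∧not⟧+⟦⟧≤⟦⟧+⟦⟧ (inCclosed p A y) (A y) (G y) (Core y) (E y) (G⊆A y) (G⊆Core y)
                  (closure A G⊆A y ∘ inCclosed⇒WithinDist p A y)
  counting : X + # n G ≤ # n Core + # n E
  counting = begin
    X + # n G                                  ≡⟨ cong (_+ # n G) (length-filterᵇ-allSubsets n (inCopen p A)) ⟩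
    # n (inCopen p A) + # n G                  ≡⟨ ∑-distrib-+ n _ _ ⟨
    ∑ n (λ y → ⟦ inCopen p A y ⟧ + ⟦ G y ⟧)    ≤⟨ ∑-mono n pointwise ⟩
    ∑ n (λ y → ⟦ Core y ⟧ + ⟦ E y ⟧)           ≡⟨ ∑-distrib-+ n _ _ ⟩
    # n Core + # n E                           ∎
  arith₁ : ∀ x b s → x + (b + s + 1) ≡ x + suc b + s
  arith₁ = solve-∀
  arith₂ : ∀ c s → c + s + s ≡ c + 2 * s
  arith₂ = solve-∀

2k+1≡k+suc[k] : ∀ k → 2 * k + 1 ≡ k + suc k
2k+1≡k+suc[k] = solve-∀

-- The odd case n = 2K+1, with p = K + t, t = u + 1 and a = n − p.
module Parameters {n K a u : ℕ} (n≡ : n ≡ suc (K + K)) (a+t≡ : a + suc u ≡ suc K) (t<K : suc u < K) where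

  t≤K : suc u ≤ K
  t≤K = <⇒≤ t<K

  a+p≡n : a + (K + suc u) ≡ n
  a+p≡n = begin
    a + (K + suc u) ≡⟨ swap a K (suc u) ⟩
    K + (a + suc u) ≡⟨ cong (K +_) a+t≡ ⟩
    K + suc K       ≡⟨ +-suc K K ⟩
    suc (K + K)     ≡⟨ n≡ ⟨
    n               ∎
    where
    open ≡-Reasoning
    swap : ∀ a K t → a + (K + t) ≡ K + (a + t)
    swap = solve-∀

  a+2t≤n : a + suc u + suc u ≤ n
  a+2t≤n = begin
    a + suc u + suc u ≡⟨ cong (_+ suc u) a+t≡ ⟩
    suc K + suc u     ≤⟨ +-monoʳ-≤ (suc K) t≤K ⟩
    suc (K + K)       ≡⟨ n≡ ⟨
    n                 ∎
    where open ≤-Reasoning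

  a+t≤n : a + suc u ≤ n
  a+t≤n = m+n≤o⇒m≤o _ a+2t≤n

  p<n : K + suc u < n
  p<n = subst (K + suc u <_) (sym n≡) (s≤s (+-monoʳ-≤ K t≤K))

  t+[K+1]≤n : suc u + suc K ≤ n
  t+[K+1]≤n = subst (suc u + suc K ≤_) (sym n≡) (s≤s (≤-trans (≤-reflexive (+-suc u K)) (+-monoˡ-≤ K t≤K)))

_≟ₛ_ : ∀ {n} (x y : Subset n) → Dec (x ≡ y)
_≟ₛ_ = ≡-dec _≟ᵇ_

-- With t = u + 1: segment is the initial segment of the simplicial order formed by the sets of
-- size < t and the t-sets meeting [a], and segment⁺ adds its successor x₀. In the odd case the
-- sets in excess are the only ones of size K + 1 that can be within distance p of segment⁺.
module Families {n : ℕ} (a u : ℕ) where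

  x₀ : Subset n
  x₀ = block a (suc u)

  segment : Subset n → Bool
  segment y = (∣ y ∣ ≤ᵇ u) ∨ (meetsFirst a y ∧ (∣ y ∣ ≡ᵇ suc u))

  segment⁺ : Subset n → Bool
  segment⁺ y = segment y ∨ ⌊ y ≟ₛ x₀ ⌋

  excess : Subset n → Bool
  excess y = not (∣ x₀ ∩ y ∣ ≡ᵇ 0) ∧ (containsFirst a y ∧ (∣ y ∣ ≡ᵇ a + suc u))

  small∈segment : ∀ {y} → ∣ y ∣ ≤ u → T (segment y)
  small∈segment ∣y∣≤u = Equivalence.from T-∨ (inj₁ (≤⇒≤ᵇ ∣y∣≤u))

  meeting∈segment : ∀ {y} → T (meetsFirst a y) → ∣ y ∣ ≡ suc u → T (segment y)
  meeting∈segment {y} meets ∣y∣≡ =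
    Equivalence.from (T-∨ {∣ y ∣ ≤ᵇ u}) (inj₂ (Equivalence.from T-∧ (meets , ≡⇒≡ᵇ _ _ ∣y∣≡)))

  segment⊆segment⁺ : segment ⊆ᶠ segment⁺
  segment⊆segment⁺ y y∈ = Equivalence.from T-∨ (inj₁ y∈)

  x₀∈segment⁺ : T (segment⁺ x₀)
  x₀∈segment⁺ = Equivalence.from (T-∨ {segment x₀}) (inj₂ (fromWitness {a? = x₀ ≟ₛ x₀} refl))

  x₀∉segment : a + suc u ≤ n → ¬ T (segment x₀)
  x₀∉segment a+t≤n x₀∈ with Equivalence.to (T-∨ {∣ x₀ ∣ ≤ᵇ u}) x₀∈
  ... | inj₁ ∣x₀∣≤u = <-irrefl refl (subst (_≤ u) (∣block∣ a (suc u) a+t≤n) (≤ᵇ⇒≤ _ u ∣x₀∣≤u))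
  ... | inj₂ m∧e    = block-avoidsFirst a (suc u) (proj₁ (Equivalence.to T-∧ m∧e))

  segment⁺-cases : a + suc u ≤ n → ∀ x → T (segment⁺ x) →
    ∣ x ∣ ≤ u ⊎ (∣ x ∣ ≡ suc u × (∀ z → T (minSymDiffInFirst z x) → ∣ z ∣ ≡ suc u → T (meetsFirst a z)))
  segment⁺-cases a+t≤n x x∈ with Equivalence.to (T-∨ {segment x}) x∈
  ... | inj₂ x≡x₀ with refl ← toWitness x≡x₀ = inj₂ (∣block∣ a (suc u) a+t≤n , block-least a (suc u))
  ... | inj₁ x∈seg with Equivalence.to (T-∨ {∣ x ∣ ≤ᵇ u}) x∈seg
  ...   | inj₁ ∣x∣≤u = inj₁ (≤ᵇ⇒≤ _ u ∣x∣≤u)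
  ...   | inj₂ m∧e with Equivalence.to T-∧ m∧e
  ...     | meets , ∣x∣≡ = inj₂ (≡ᵇ⇒≡ _ _ ∣x∣≡ , λ z first _ → minSymDiff-meetsFirst a z x first meets)

  ∣segment⁺∣≤ : a + suc u ≤ n → ∀ x → T (segment⁺ x) → ∣ x ∣ ≤ suc u
  ∣segment⁺∣≤ a+t≤n x x∈ with segment⁺-cases a+t≤n x x∈
  ... | inj₁ ∣x∣≤u       = m≤n⇒m≤1+n ∣x∣≤u
  ... | inj₂ (∣x∣≡ , _)  = ≤-reflexive ∣x∣≡

  segment⁺-predecessors : a + suc u ≤ n → ∀ x → T (segment⁺ x) → (λ z → z <ₛ x) ⊆ᶠ segment
  segment⁺-predecessors a+t≤n x x∈ z z<x with segment⁺-cases a+t≤n x x∈ | <ₛ-cases z x z<x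
  ... | inj₁ ∣x∣≤u             | _              = small∈segment (≤-trans (<ₛ⇒∣∣≤ z x z<x) ∣x∣≤u)
  ... | inj₂ (∣x∣≡ , _)        | inj₁ lt        = small∈segment (≤-pred (≤-trans lt (≤-reflexive ∣x∣≡)))
  ... | inj₂ (∣x∣≡ , earlier)  | inj₂ (eq , first) =
    meeting∈segment (earlier z first (trans eq ∣x∣≡)) (trans eq ∣x∣≡)

  #segment+s : ∀ p → a + p ≡ n → # n segment + p C suc u ≡ sumTo (suc u) (n C_)
  #segment+s p a+p≡n = begin
    # n segment + p C suc u
      ≡⟨ cong (_+ p C suc u) (trans (∑-cong n split) (∑-distrib-+ n _ _)) ⟩
    small + meeting + p C suc u
      ≡⟨ cong (small + meeting +_) (#-avoidsFirst a p (suc u) a+p≡n) ⟨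
    small + meeting + avoiding
      ≡⟨ rearrange small meeting avoiding ⟩
    small + (avoiding + meeting)
      ≡⟨ cong (small +_) (∑-distrib-+ n _ _) ⟨
    small + ∑ n (λ y → ⟦ not (meetsFirst a y) ∧ size y ⟧ + ⟦ meets y ⟧)
      ≡⟨ cong (small +_) (∑-cong n (λ y → ⟦not∧⟧+⟦∧⟧ (meetsFirst a y) (size y))) ⟩
    small + # n size
      ≡⟨ cong₂ _+_ (#-size≤ n u) (#-size≡ n (suc u)) ⟩
    sumTo u (n C_) + n C suc u
      ≡⟨ sumTo-suc u (n C_) ⟨
    sumTo (suc u) (n C_) ∎
    where
    open ≡-Reasoning
    size meets : Subset n → Bool
    size y  = ∣ y ∣ ≡ᵇ suc u
    meets y = meetsFirst a y ∧ size y
    small = # n (λ y → ∣ y ∣ ≤ᵇ u)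
    meeting = # n meets
    avoiding = # n (λ y → not (meetsFirst a y) ∧ size y)
    split : ∀ y → ⟦ segment y ⟧ ≡ ⟦ ∣ y ∣ ≤ᵇ u ⟧ + ⟦ meets y ⟧
    split y = ⟦∨⟧ (∣ y ∣ ≤ᵇ u) (meets y) λ ∣y∣≤u m∧e →
      let ∣y∣≡t = ≡ᵇ⇒≡ ∣ y ∣ (suc u) (proj₂ (Equivalence.to (T-∧ {meetsFirst a y}) m∧e))
      in <-irrefl refl (subst (_≤ u) ∣y∣≡t (≤ᵇ⇒≤ ∣ y ∣ u ∣y∣≤u))
    rearrange : ∀ a b c → a + b + c ≡ a + (c + b)
    rearrange = solve-∀

  #segment<#segment⁺ : a + suc u ≤ n → suc (# n segment) ≤ # n segment⁺
  #segment<#segment⁺ a+t≤n = begin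
    suc (# n segment)
      ≡⟨ +-comm 1 _ ⟩
    # n segment + 1
      ≡⟨ cong (# n segment +_) (⟦⟧≡1 (fromWitness {a? = x₀ ≟ₛ x₀} refl)) ⟨
    # n segment + ⟦ ⌊ x₀ ≟ₛ x₀ ⌋ ⟧
      ≤⟨ +-monoʳ-≤ (# n segment) (term≤∑ n (λ y → ⟦ ⌊ y ≟ₛ x₀ ⌋ ⟧) x₀) ⟩
    # n segment + # n (λ y → ⌊ y ≟ₛ x₀ ⌋)
      ≡⟨ trans (∑-cong n split) (∑-distrib-+ n _ _) ⟨
    # n segment⁺ ∎
    where
    open ≤-Reasoning
    split : ∀ y → ⟦ segment⁺ y ⟧ ≡ ⟦ segment y ⟧ + ⟦ ⌊ y ≟ₛ x₀ ⌋ ⟧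
    split y = ⟦∨⟧ (segment y) ⌊ y ≟ₛ x₀ ⌋ λ y∈ y≡x₀ →
      x₀∉segment a+t≤n (subst (T ∘ segment) (toWitness y≡x₀) y∈)

  #excess<s : ∀ p → a + p ≡ n → a + suc u + suc u ≤ n → suc (# n excess) ≤ p C suc u
  #excess<s p a+p≡n a+2t≤n = begin
    suc (# n excess)
      ≡⟨ +-comm 1 _ ⟩
    # n excess + 1
      ≡⟨ cong (# n excess +_) (⟦⟧≡1 y₀-included) ⟨
    # n excess + ⟦ included y₀ ⟧
      ≤⟨ +-monoʳ-≤ (# n excess) (term≤∑ n (⟦_⟧ ∘ included) y₀) ⟩
    # n excess + # n included
      ≡⟨ trans (sym (∑-distrib-+ n _ _)) (∑-cong n (λ y → ⟦not∧⟧+⟦∧⟧ (disjoint y) (candidate y))) ⟩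
    # n candidate
      ≡⟨ #-containsFirst a p (suc u) a+p≡n ⟩
    p C suc u ∎
    where
    open ≤-Reasoning
    disjoint candidate included : Subset n → Bool
    disjoint y  = ∣ x₀ ∩ y ∣ ≡ᵇ 0
    candidate y = containsFirst a y ∧ (∣ y ∣ ≡ᵇ a + suc u)
    included y  = disjoint y ∧ candidate y
    y₀ : Subset n
    y₀ = firstOutside x₀ (a + suc u)
    ∣x₀∣≡ : ∣ x₀ ∣ ≡ suc u
    ∣x₀∣≡ = ∣block∣ a (suc u) (m+n≤o⇒m≤o _ a+2t≤n)
    y₀-included : T (included y₀)
    y₀-included = Equivalence.from T-∧
      ( ≡⇒≡ᵇ _ _ (trans (cong ∣_∣ (∩-comm x₀ y₀)) (firstOutside-disjoint x₀ (a + suc u)))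
      , Equivalence.from T-∧
          ( firstOutside-containsFirst a x₀ (suc u) (block-avoidsFirst a (suc u))
          , ≡⇒≡ᵇ _ _ (∣firstOutside∣ x₀ (a + suc u) (subst (λ k → a + suc u + k ≤ n) (sym ∣x₀∣≡) a+2t≤n))))

  closure⊆core∪excess : ∀ K (A : Subset n → Bool) y → n ≡ suc (K + K) → a + suc u ≡ suc K → suc u < K →
    segment⁺ ⊆ᶠ A → WithinDist (K + suc u) A y → ∣ y ∣ ≤ K ⊎ T (excess y)
  closure⊆core∪excess K A y n≡ a+t≡ t<K segment⁺⊆A within with ∣ y ∣ ≤? K
  ... | yes ∣y∣≤K = inj₁ ∣y∣≤K
  ... | no  ∣y∣≰K =
    inj₂ (Equivalence.from T-∧ (T-not x₀-meets-y , Equivalence.from T-∧ (containsFirst-y , ≡⇒≡ᵇ _ _ ∣y∣≡)))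
    where
    open Parameters n≡ a+t≡ t<K using (p<n; t+[K+1]≤n)
    p≡ : K + suc u ≡ u + suc K
    p≡ = trans (+-suc K u) (trans (cong suc (+-comm K u)) (sym (+-suc u K)))
    ∣y∣≤1+K : ∣ y ∣ ≤ suc K
    ∣y∣≤1+K = +-cancelˡ-≤ u _ _ (subst (u + ∣ y ∣ ≤_) p≡
      (WithinDist-size u (K + suc u) A y
        (λ x ∣x∣≤u → segment⁺⊆A x (segment⊆segment⁺ x (small∈segment ∣x∣≤u))) within p<n))
    ∣y∣≡1+K : ∣ y ∣ ≡ suc K
    ∣y∣≡1+K = ≤-antisym ∣y∣≤1+K (≰⇒> ∣y∣≰K)
    ∣y∣≡ : ∣ y ∣ ≡ a + suc u
    ∣y∣≡ = trans ∣y∣≡1+K (sym a+t≡)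
    t+∣y∣≤n : suc u + ∣ y ∣ ≤ n
    t+∣y∣≤n = subst (λ k → suc u + k ≤ n) (sym ∣y∣≡1+K) t+[K+1]≤n
    far : ∀ x → ∣ x ∩ y ∣ ≡ 0 → ∣ x ∣ ≡ suc u → ¬ T (A x)
    far x disjoint ∣x∣≡ = WithinDist-disjoint (K + suc u) A y x within disjoint
      (subst (K + suc u <_) (cong₂ _+_ (sym ∣x∣≡) (sym ∣y∣≡1+K)) (s≤s (≤-reflexive p≡)))
    x₀-meets-y : ¬ T (∣ x₀ ∩ y ∣ ≡ᵇ 0)
    x₀-meets-y disjoint = far x₀ (≡ᵇ⇒≡ _ 0 disjoint)
      (∣block∣ a (suc u) (subst (_≤ n) ∣y∣≡ (≤-trans (m≤n+m ∣ y ∣ (suc u)) t+∣y∣≤n)))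
      (segment⁺⊆A x₀ x₀∈segment⁺)
    containsFirst-y : T (containsFirst a y)
    containsFirst-y = firstOutside-avoidsFirst⇒containsFirst a y u λ meets →
      far x (firstOutside-disjoint y (suc u)) ∣x∣≡
        (segment⁺⊆A x (segment⊆segment⁺ x (meeting∈segment meets ∣x∣≡)))
      where
      x = firstOutside y (suc u)
      ∣x∣≡ = ∣firstOutside∣ y (suc u) t+∣y∣≤n

oddBound : ∀ K p u a → p ≡ K + suc u → a + suc u ≡ suc K → suc u < K →
  cardCpI (2 * K + 1) p (sumTo (p ∸ K) (λ i → (2 * K + 1) C i) ∸ (p C (p ∸ K)) + 1)
    + (sumTo (p ∸ K) (λ i → (2 * K + 1) C i) + 1) < 2 ^ (2 * K) + 2 * (p C (p ∸ K))
oddBound K _ u a refl a+t≡ t<K rewrite m+n∸m≡n K (suc u) =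
  subst (λ c → cardCpI n p (R ∸ s + 1) + (R + 1) < c + 2 * s) (#-size≤-half K refl)
  (cardCpI-bound p s R segment segment⁺ core excess
    (#segment+s p a+p≡n) (#segment<#segment⁺ a+t≤n) (#excess<s p a+p≡n a+2t≤n)
    (segment⁺-predecessors a+t≤n) segment⁺⊆core
    (λ A segment⁺⊆A y within → map₁ ≤⇒≤ᵇ (closure⊆core∪excess K A y n≡ a+t≡ t<K segment⁺⊆A within)))
  where
  n = 2 * K + 1
  p = K + suc u
  s = p C suc u
  R = sumTo (suc u) (n C_)
  n≡ : n ≡ suc (K + K)
  n≡ = trans (2k+1≡k+suc[k] K) (+-suc K K)
  open Families {n} a u
  open Parameters n≡ a+t≡ t<K
  core : Subset n → Bool
  core y = ∣ y ∣ ≤ᵇ K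
  segment⁺⊆core : segment⁺ ⊆ᶠ core
  segment⁺⊆core x x∈ = ≤⇒≤ᵇ (≤-trans (∣segment⁺∣≤ a+t≤n x x∈) t≤K)

byFirst : ∀ {n} {A : Set} → (Subset n → A) → (Subset n → A) → Subset (suc n) → A
byFirst f g (true ∷ x)  = f x
byFirst f g (false ∷ x) = g x

module EvenFamilies {n : ℕ} (a u : ℕ) where

  open Families {n} a u

  evenSegment evenSegment⁺ evenExcess : Subset (suc n) → Bool
  evenSegment  = byFirst segment  (λ w → ∣ w ∣ ≤ᵇ suc u)
  evenSegment⁺ = byFirst segment⁺ (λ w → ∣ w ∣ ≤ᵇ suc u)
  evenExcess   = byFirst (λ _ → false) excess

  evenCore : ℕ → Subset (suc n) → Bool
  evenCore K = byFirst (λ w → ∣ w ∣ ≤ᵇ K) (λ w → ∣ w ∣ ≤ᵇ K)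

  small∈evenSegment⁺ : ∀ x → ∣ x ∣ ≤ suc u → T (evenSegment⁺ x)
  small∈evenSegment⁺ (true ∷ w)  ∣x∣≤t = segment⊆segment⁺ w (small∈segment (≤-pred ∣x∣≤t))
  small∈evenSegment⁺ (false ∷ w) ∣x∣≤t = ≤⇒≤ᵇ ∣x∣≤t

  evenSegment⁺-predecessors : a + suc u ≤ n → ∀ x → T (evenSegment⁺ x) → (λ z → z <ₛ x) ⊆ᶠ evenSegment
  evenSegment⁺-predecessors a+t≤n (true ∷ w) w∈ (true ∷ z) z<x = segment⁺-predecessors a+t≤n w w∈ z z<x
  evenSegment⁺-predecessors a+t≤n (true ∷ w) w∈ (false ∷ z) z<x with <ₛ-cases (false ∷ z) (true ∷ w) z<x
  ... | inj₁ ∣z∣<1+∣w∣ = ≤⇒≤ᵇ (≤-trans (≤-pred ∣z∣<1+∣w∣) (∣segment⁺∣≤ a+t≤n w w∈))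
  evenSegment⁺-predecessors a+t≤n (false ∷ w) ∣w∣≤t (true ∷ z) z<x =
    small∈segment (≤-pred (≤-trans (<ₛ⇒∣∣≤ (true ∷ z) (false ∷ w) z<x) (≤ᵇ⇒≤ ∣ w ∣ _ ∣w∣≤t)))
  evenSegment⁺-predecessors a+t≤n (false ∷ w) ∣w∣≤t (false ∷ z) z<x =
    ≤⇒≤ᵇ (≤-trans (<ₛ⇒∣∣≤ (false ∷ z) (false ∷ w) z<x) (≤ᵇ⇒≤ ∣ w ∣ _ ∣w∣≤t))

  evenClosure⊆core∪excess : ∀ K (A : Subset (suc n) → Bool) y → n ≡ suc (K + K) → a + suc u ≡ suc K → suc u < K →
    evenSegment⁺ ⊆ᶠ A → WithinDist (suc K + suc u) A y → T (evenCore K y) ⊎ T (evenExcess y)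
  evenClosure⊆core∪excess K A (true ∷ w) n≡ a+t≡ t<K evenSegment⁺⊆A within =
    inj₁ (≤⇒≤ᵇ (≤-pred (+-cancelˡ-≤ (suc u) _ _ (subst (suc u + suc ∣ w ∣ ≤_) (+-comm (suc K) (suc u)) t+∣y∣≤p))))
    where
    t+∣y∣≤p : suc u + ∣ true ∷ w ∣ ≤ suc K + suc u
    t+∣y∣≤p = WithinDist-size (suc u) (suc K + suc u) A (true ∷ w)
      (λ x ∣x∣≤t → evenSegment⁺⊆A x (small∈evenSegment⁺ x ∣x∣≤t)) within (s≤s (Parameters.p<n n≡ a+t≡ t<K))
  evenClosure⊆core∪excess K A (false ∷ w) n≡ a+t≡ t<K evenSegment⁺⊆A within =
    map₁ ≤⇒≤ᵇ (closure⊆core∪excess K (A ∘ (true ∷_)) w n≡ a+t≡ t<K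
      (λ x x∈ → evenSegment⁺⊆A (true ∷ x) x∈) (λ x x∈ → ≤-pred (within (true ∷ x) x∈)))

evenBound : ∀ K p u a → p ≡ suc K + suc u → a + suc u ≡ suc K → suc u < K →
  cardCpI (2 * suc K) p
      (sumTo (p ∸ suc K) (λ i → (2 * suc K) C i) + ((2 * suc K ∸ 1) C (p ∸ suc K)) ∸ ((p ∸ 1) C (p ∸ suc K)) + 1)
    + (sumTo (p ∸ suc K) (λ i → (2 * suc K) C i) + ((2 * suc K ∸ 1) C (p ∸ suc K)) + 1)
    < 2 ^ (2 * suc K ∸ 1) + 2 * ((p ∸ 1) C (p ∸ suc K))
evenBound K _ u a refl a+t≡ t<K rewrite m+n∸m≡n (suc K) (suc u) =
  subst (λ c → cardCpI (suc n) (suc p) (R ∸ s + 1) + (R + 1) < c + 2 * s) #evenCore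
  (cardCpI-bound (suc p) s R evenSegment evenSegment⁺ (evenCore K) evenExcess
    #evenSegment+s
    (+-monoˡ-≤ (# n (λ w → ∣ w ∣ ≤ᵇ suc u)) (#segment<#segment⁺ a+t≤n))
    (subst (λ e → suc (e + # n excess) ≤ s) (sym (∑-zero n)) (#excess<s p a+p≡n a+2t≤n))
    (evenSegment⁺-predecessors a+t≤n) evenSegment⁺⊆core
    (λ A evenSegment⁺⊆A y → evenClosure⊆core∪excess K A y n≡ a+t≡ t<K evenSegment⁺⊆A))
  where
  n = K + suc (K + 0)
  p = K + suc u
  s = p C suc u
  R = sumTo (suc u) (suc n C_) + n C suc u
  n≡ : n ≡ suc (K + K)
  n≡ = trans (+-suc K (K + 0)) (cong (λ k → suc (K + k)) (+-identityʳ K))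
  open Families {n} a u
  open EvenFamilies {n} a u
  open Parameters n≡ a+t≡ t<K
  #evenSegment+s : # (suc n) evenSegment + s ≡ R
  #evenSegment+s = begin
    (# n segment + τ) + s            ≡⟨ swap (# n segment) τ s ⟩
    (# n segment + s) + τ            ≡⟨ cong₂ _+_ (#segment+s p a+p≡n) (#-size≤ n (suc u)) ⟩
    sumTo (suc u) (n C_) + sumTo (suc u) (n C_)   ≡⟨ cong (_+ sumTo (suc u) (n C_)) (sumTo-suc u (n C_)) ⟩
    (sumTo u (n C_) + n C suc u) + sumTo (suc u) (n C_) ≡⟨ swap (sumTo u (n C_)) (n C suc u) _ ⟩
    (sumTo u (n C_) + sumTo (suc u) (n C_)) + n C suc u ≡⟨ cong (_+ n C suc u) (sumTo-Pascal n u) ⟨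
    R                                ∎
    where
    open ≡-Reasoning
    τ = # n (λ w → ∣ w ∣ ≤ᵇ suc u)
    swap : ∀ x y z → x + y + z ≡ x + z + y
    swap = solve-∀
  evenSegment⁺⊆core : evenSegment⁺ ⊆ᶠ evenCore K
  evenSegment⁺⊆core (true ∷ w)  w∈    = ≤⇒≤ᵇ (≤-trans (∣segment⁺∣≤ a+t≤n w w∈) t≤K)
  evenSegment⁺⊆core (false ∷ w) ∣w∣≤t = ≤⇒≤ᵇ (≤-trans (≤ᵇ⇒≤ ∣ w ∣ _ ∣w∣≤t) t≤K)
  #evenCore : # (suc n) (evenCore K) ≡ 2 ^ n
  #evenCore = begin
    half + half                  ≡⟨ cong₂ _+_ (#-size≤-half K n≡2K+1) (#-size≤-half K n≡2K+1) ⟩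
    2 ^ (2 * K) + 2 ^ (2 * K)    ≡⟨ cong (2 ^ (2 * K) +_) (+-identityʳ _) ⟨
    2 ^ suc (2 * K)              ≡⟨ cong (2 ^_) (trans (+-comm 1 (2 * K)) (sym n≡2K+1)) ⟩
    2 ^ n                        ∎
    where
    open ≡-Reasoning
    half = # n (λ w → ∣ w ∣ ≤ᵇ K)
    n≡2K+1 : n ≡ 2 * K + 1
    n≡2K+1 = arith K
      where
      arith : ∀ K → K + suc (K + 0) ≡ 2 * K + 1
      arith = solve-∀

p≡k+suc[p∸[k+1]] : ∀ k {p} → k + 1 ≤ p → p ≡ k + suc (p ∸ (k + 1))
p≡k+suc[p∸[k+1]] k k+1≤p = trans (sym (m+[n∸m]≡n k+1≤p)) (+-assoc k 1 _)

p+2≤k+suc[m]⇒suc[u]<m : ∀ k u m p → p ≡ k + suc u → p + 2 ≤ k + suc m → suc u < m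
p+2≤k+suc[m]⇒suc[u]<m k u m p p≡ h =
  ≤-pred (+-cancelˡ-≤ k _ _ (subst (_≤ k + suc m) (trans (cong (_+ 2) p≡) (rearrange k u)) h))
  where
  rearrange : ∀ k u → k + suc u + 2 ≡ k + suc (suc (suc u))
  rearrange = solve-∀

m∸n+suc[n]≡suc[m] : ∀ {m n} → n ≤ m → m ∸ n + suc n ≡ suc m
m∸n+suc[n]≡suc[m] {m} {n} n≤m = trans (+-suc (m ∸ n) n) (cong suc (m∸n+n≡m n≤m))

corollary3p6 : (∀ (k p : ℕ) → k + 1 ≤ p → p + 2 ≤ 2 * k + 1 →
      cardCpI (2 * k + 1) p (sumTo (p ∸ k) (λ i → (2 * k + 1) C i) ∸ (p C (p ∸ k)) + 1)
        + (sumTo (p ∸ k) (λ i → (2 * k + 1) C i) + 1)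
        < 2 ^ (2 * k) + 2 * (p C (p ∸ k)))
    ×
    (∀ (k p : ℕ) → k + 1 ≤ p → p + 2 ≤ 2 * k →
      cardCpI (2 * k) p
          (sumTo (p ∸ k) (λ i → (2 * k) C i) + ((2 * k ∸ 1) C (p ∸ k)) ∸ ((p ∸ 1) C (p ∸ k)) + 1)
        + (sumTo (p ∸ k) (λ i → (2 * k) C i) + ((2 * k ∸ 1) C (p ∸ k)) + 1)
        < 2 ^ (2 * k ∸ 1) + 2 * ((p ∸ 1) C (p ∸ k)))
corollary3p6 =
    (λ k p k+1≤p p+2≤n →
       let p≡ = p≡k+suc[p∸[k+1]] k k+1≤p
           t<k = p+2≤k+suc[m]⇒suc[u]<m k _ k p p≡ (subst (p + 2 ≤_) (2k+1≡k+suc[k] k) p+2≤n)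
       in oddBound k p _ _ p≡ (m∸n+suc[n]≡suc[m] (≤-trans (n≤1+n _) (<⇒≤ t<k))) t<k)
  , λ { zero p _ p+2≤0 → ⊥-elim (<⇒≱ z<s (≤-trans (m≤n+m 2 p) p+2≤0))
      ; (suc K) p k+1≤p p+2≤n →
          let p≡ = p≡k+suc[p∸[k+1]] (suc K) k+1≤p
              t<K = p+2≤k+suc[m]⇒suc[u]<m (suc K) _ K p p≡
                      (subst (p + 2 ≤_) (cong (suc K +_) (+-identityʳ (suc K))) p+2≤n)
          in evenBound K p _ _ p≡ (m∸n+suc[n]≡suc[m] (≤-trans (n≤1+n _) (<⇒≤ t<K))) t<K }
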